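{- Let $\langle\chi,\vec a\rangle$ be a loop and $\check\phi$ a quantifier-free formula over $\vec x$, where $\chi(\vec x)\equiv\bigwedge_{i=1}^k C_i$ in CNF and each clause $C_i$ contains an inequation $e_i(\vec x)>0$ (as one of its disjuncts) such that \[ \check\phi(\vec x)\land e_i(\vec x)\le e_i(\vec a(\vec x))\implies e_i(\vec a(\vec x))\le e_i(\vec a^2(\vec x)) \] is valid for each $i$. Then mapping $(\langle\chi,\vec a\rangle,\check\phi)$ to \[ \bigwedge_{i=1}^k 0<e_i(\vec x)\le e_i(\vec a(\vec x)) \] is a conditional non-termination technique; i.e., every $\vec x\in\mathbb Z^d$ that is a witness of non-termination for $\langle\check\phi,\vec a\rangle$ and satisfies $\bigwedge_{i=1}^k 0<e_i(\vec x)\le e_i(\vec a(\vec x))$ is a witness of non-termination for $\langle\chi,\vec a\rangle$.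
   Context: Fix $d\ge 1$ and integer variables $\vec x=(x_1,\dots,x_d)$. A loop $\langle\chi,\vec a\rangle$ consists of a quantifier-free formula $\chi$ over atoms $p>0$ ($p$ an arithmetic expression over $\vec x$, integer semantics) and a map $\vec a:\mathbb Z^d\to\mathbb Z^d$ given by expressions over $\vec x$; $\vec a^m$ is $m$-fold application ($\vec a^0=\mathrm{id}$). A vector $\vec x\in\mathbb Z^d$ is a witness of non-termination for $\langle\chi,\vec a\rangle$ if $\chi(\vec a^m(\vec x))$ holds for all $m\in\mathbb N$. A conditional non-termination technique is a partial function $\mathit{nt}$ mapping pairs (loop $\langle\chi,\vec a\rangle$, quantifier-free formula $\check\phi$ over $\vec x$) to quantifier-free formulas over $\vec x$ such that for all pairs in its domain and all $\vec x$: if $\vec x$ is a witness of non-termination for $\langle\check\phi,\vec a\rangle$ and $\mathit{nt}(\langle\chi,\vec a\rangle,\check\phi)(\vec x)$ holds, then $\vec x$ is a witness of non-termination for $\langle\chi,\vec a\rangle$. Validity means truth for all integer values of the free variables. -}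

module Defs where

open import Data.Nat using (ℕ; zero; suc)
open import Data.Fin using (Fin)
open import Data.Integer using (ℤ; _+_; _*_; -_; _-_; _<_; 0ℤ)
open import Data.List using (List; []; _∷_)
open import Data.Product using (_×_)
open import Data.Sum using (_⊎_)
open import Data.Unit using (⊤)
open import Data.Empty using (⊥)
open import Relation.Nullary using (¬_)

data Expr (d : ℕ) : Set where
  var   : Fin d → Expr d
  const : ℤ → Expr d
  _⊕_   : Expr d → Expr d → Expr d
  _⊗_   : Expr d → Expr d → Expr d
  ⊖_    : Expr d → Expr d

Val : ℕ → Set
Val d = Fin d → ℤ

eval : ∀ {d} → Expr d → Val d → ℤ
eval (var i)   x = x i
eval (const c) x = c
eval (e ⊕ f)   x = eval e x + eval f x
eval (e ⊗ f)   x = eval e x * eval f x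
eval (⊖ e)     x = - eval e x

data Formula (d : ℕ) : Set where
  gt0  : Expr d → Formula d
  true false : Formula d
  _∧ᶠ_ _∨ᶠ_ : Formula d → Formula d → Formula d
  ¬ᶠ_  : Formula d → Formula d

⟦_⟧ : ∀ {d} → Formula d → Val d → Set
⟦ gt0 p ⟧   x = 0ℤ < eval p x
⟦ true ⟧    x = ⊤
⟦ false ⟧   x = ⊥
⟦ φ ∧ᶠ ψ ⟧  x = ⟦ φ ⟧ x × ⟦ ψ ⟧ x
⟦ φ ∨ᶠ ψ ⟧  x = ⟦ φ ⟧ x ⊎ ⟦ ψ ⟧ x
⟦ ¬ᶠ φ ⟧    x = ¬ ⟦ φ ⟧ x

_≤ᶠ_ : ∀ {d} → Expr d → Expr d → Formula d
p ≤ᶠ q = ¬ᶠ gt0 (p ⊕ (⊖ q))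

_⇒ᶠ_ : ∀ {d} → Formula d → Formula d → Formula d
φ ⇒ᶠ ψ = (¬ᶠ φ) ∨ᶠ ψ

Valid : ∀ {d} → Formula d → Set
Valid {d} φ = (x : Val d) → ⟦ φ ⟧ x

Update : ℕ → Set
Update d = Fin d → Expr d

_[_] : ∀ {d} → Expr d → Update d → Expr d
var i   [ a ] = a i
const c [ a ] = const c
(e ⊕ f) [ a ] = (e [ a ]) ⊕ (f [ a ])
(e ⊗ f) [ a ] = (e [ a ]) ⊗ (f [ a ])
(⊖ e)   [ a ] = ⊖ (e [ a ])

apply : ∀ {d} → Update d → Val d → Val d
apply a x i = eval (a i) x

iter : ∀ {d} → Update d → ℕ → Val d → Val d
iter a zero    x = x
iter a (suc m) x = apply a (iter a m x)

record Loop (d : ℕ) : Set where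
  constructor ⟨_,_⟩
  field
    guard  : Formula d
    update : Update d

WitnessNT : ∀ {d} → Loop d → Val d → Set
WitnessNT ⟨ χ , a ⟩ x = (m : ℕ) → ⟦ χ ⟧ (iter a m x)

data Lit (d : ℕ) : Set where
  pos : Expr d → Lit d
  neg : Expr d → Lit d

Clause : ℕ → Set
Clause d = List (Lit d)

CNF : ℕ → Set
CNF d = List (Clause d)

litF : ∀ {d} → Lit d → Formula d
litF (pos p) = gt0 p
litF (neg p) = ¬ᶠ gt0 p

clauseF : ∀ {d} → Clause d → Formula d
clauseF []       = false
clauseF (l ∷ ls) = litF l ∨ᶠ clauseF ls

cnfF : ∀ {d} → CNF d → Formula d
cnfF []       = true
cnfF (c ∷ cs) = clauseF c ∧ᶠ cnfF cs

MonoHyp : ∀ {d} → Formula d → Update d → Expr d → Set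
MonoHyp φ a e =
  Valid ((φ ∧ᶠ (e ≤ᶠ (e [ a ]))) ⇒ᶠ ((e [ a ]) ≤ᶠ ((e [ a ]) [ a ])))

ntFormula : ∀ {d} → Update d → List (Expr d) → Formula d
ntFormula a []       = true
ntFormula a (e ∷ es) = (gt0 e ∧ᶠ (e ≤ᶠ (e [ a ]))) ∧ᶠ ntFormula a es

-- Along an orbit on which φ̌ holds, the hypothesis on e_i says that
-- "e_i does not decrease in the next step" is inherited by the following step.
-- Since it holds at the start, e_i is nondecreasing along the whole orbit and,
-- starting positive, stays positive; so the designated literal e_i > 0 of every
-- clause C_i holds at every iterate.
module Submission where

open import Defs
open import Data.Nat using (ℕ; _≤_; zero; suc)
open import Data.Integer using (ℤ; 0ℤ; _+_; _*_; -_)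
  renaming (_≤_ to _≤ℤ_; _<_ to _<ℤ_)
open import Data.Integer.Properties
  using (i-j≤0⇒i≤j; i≤j⇒i-j≤0; ≮⇒≥; <⇒≱; <-≤-trans)
open import Data.List using (List; []; _∷_)
open import Data.List.Membership.Propositional using (_∈_)
open import Data.List.Relation.Unary.All using (All; []; _∷_)
open import Data.List.Relation.Unary.Any using (here; there)
open import Data.List.Relation.Binary.Pointwise using (Pointwise; []; _∷_)
open import Data.Product using (_,_)
open import Data.Sum using (inj₁; inj₂)
open import Data.Unit using (tt)
open import Data.Empty using (⊥-elim)
open import Relation.Binary.PropositionalEquality
  using (_≡_; refl; sym; cong; cong₂; subst; subst₂)

eval-[] : ∀ {d} (e : Expr d) (a : Update d) (x : Val d) →
          eval (e [ a ]) x ≡ eval e (apply a x)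
eval-[] (var i)   a x = refl
eval-[] (const c) a x = refl
eval-[] (e ⊕ f)   a x = cong₂ _+_ (eval-[] e a x) (eval-[] f a x)
eval-[] (e ⊗ f)   a x = cong₂ _*_ (eval-[] e a x) (eval-[] f a x)
eval-[] (⊖ e)     a x = cong -_ (eval-[] e a x)

⟦≤ᶠ⟧⇒≤ : ∀ {d} (p q : Expr d) (x : Val d) → ⟦ p ≤ᶠ q ⟧ x → eval p x ≤ℤ eval q x
⟦≤ᶠ⟧⇒≤ p q x p-q≯0 = i-j≤0⇒i≤j (≮⇒≥ p-q≯0)

≤⇒⟦≤ᶠ⟧ : ∀ {d} (p q : Expr d) (x : Val d) → eval p x ≤ℤ eval q x → ⟦ p ≤ᶠ q ⟧ x
≤⇒⟦≤ᶠ⟧ p q x p≤q p-q>0 = <⇒≱ p-q>0 (i≤j⇒i-j≤0 p≤q)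

⟦≤ᶠ-[]⟧⇒≤ : ∀ {d} (p q : Expr d) (a : Update d) (x : Val d) →
            ⟦ p ≤ᶠ (q [ a ]) ⟧ x → eval p x ≤ℤ eval q (apply a x)
⟦≤ᶠ-[]⟧⇒≤ p q a x h = subst (eval p x ≤ℤ_) (eval-[] q a x) (⟦≤ᶠ⟧⇒≤ p (q [ a ]) x h)

nondecreasing-from-step : (f : ℕ → ℤ) →
  (∀ m → f m ≤ℤ f (suc m) → f (suc m) ≤ℤ f (suc (suc m))) →
  f 0 ≤ℤ f 1 → ∀ m → f m ≤ℤ f (suc m)
nondecreasing-from-step f step f₀≤f₁ zero    = f₀≤f₁
nondecreasing-from-step f step f₀≤f₁ (suc m) =
  step m (nondecreasing-from-step f step f₀≤f₁ m)

positive-if-nondecreasing : (f : ℕ → ℤ) → (∀ m → f m ≤ℤ f (suc m)) →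
  0ℤ <ℤ f 0 → ∀ m → 0ℤ <ℤ f m
positive-if-nondecreasing f mono f₀>0 zero    = f₀>0
positive-if-nondecreasing f mono f₀>0 (suc m) =
  <-≤-trans (positive-if-nondecreasing f mono f₀>0 m) (mono m)

MonoHyp⇒step : ∀ {d} {φ : Formula d} {a : Update d} {e : Expr d} →
  MonoHyp φ a e → (y : Val d) → ⟦ φ ⟧ y →
  eval e y ≤ℤ eval e (apply a y) →
  eval e (apply a y) ≤ℤ eval e (apply a (apply a y))
MonoHyp⇒step {a = a} {e} mono y φy e≤ea with mono y
... | inj₁ ¬pre = ⊥-elim (¬pre (φy , ≤⇒⟦≤ᶠ⟧ e (e [ a ]) y e≤e[a]))
  where
  e≤e[a] : eval e y ≤ℤ eval (e [ a ]) y
  e≤e[a] = subst (eval e y ≤ℤ_) (sym (eval-[] e a y)) e≤ea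
... | inj₂ post =
  subst₂ _≤ℤ_ (eval-[] e a y) (eval-[] e a (apply a y))
         (⟦≤ᶠ-[]⟧⇒≤ (e [ a ]) (e [ a ]) a y post)

positive-along-orbit : ∀ {d} {φ : Formula d} {a : Update d} {e : Expr d} →
  MonoHyp φ a e → (x : Val d) → WitnessNT ⟨ φ , a ⟩ x →
  0ℤ <ℤ eval e x → eval e x ≤ℤ eval e (apply a x) →
  ∀ m → 0ℤ <ℤ eval e (iter a m x)
positive-along-orbit {φ = φ} {a} {e} mono x φ-orbit e>0 e≤ea =
  positive-if-nondecreasing f (nondecreasing-from-step f step e≤ea) e>0
  where
  f : ℕ → ℤ
  f m = eval e (iter a m x)

  step : ∀ m → f m ≤ℤ f (suc m) → f (suc m) ≤ℤ f (suc (suc m))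
  step m = MonoHyp⇒step {φ = φ} {a} {e} mono (iter a m x) (φ-orbit m)

∈⇒⟦clauseF⟧ : ∀ {d} {C : Clause d} {l : Lit d} {y : Val d} →
  l ∈ C → ⟦ litF l ⟧ y → ⟦ clauseF C ⟧ y
∈⇒⟦clauseF⟧ (here refl) l-holds = inj₁ l-holds
∈⇒⟦clauseF⟧ (there l∈C) l-holds = inj₂ (∈⇒⟦clauseF⟧ l∈C l-holds)

theorem17 : (d : ℕ) → 1 ≤ d →
    (cs : CNF d) (a : Update d) (φ̌ : Formula d) (es : List (Expr d)) →
    Pointwise (λ C e → pos e ∈ C) cs es →
    All (MonoHyp φ̌ a) es →
    (x : Val d) →
    WitnessNT ⟨ φ̌ , a ⟩ x →
    ⟦ ntFormula a es ⟧ x →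
    WitnessNT ⟨ cnfF cs , a ⟩ x
theorem17 d d≥1 [] a φ̌ [] [] [] x φ̌-orbit nt m = tt
theorem17 d d≥1 (C ∷ cs) a φ̌ (e ∷ es) (e∈C ∷ cs∋es) (mono ∷ monos) x φ̌-orbit
          ((e>0 , e≤e[a]) , nt) m =
  ∈⇒⟦clauseF⟧ e∈C
    (positive-along-orbit {φ = φ̌} {a} {e} mono x φ̌-orbit e>0 (⟦≤ᶠ-[]⟧⇒≤ e e a x e≤e[a]) m) ,
  theorem17 d d≥1 cs a φ̌ es cs∋es monos x φ̌-orbit nt m
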